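{- For every node $u$ of the tree $T$ and every agent $i\in\{1,2\}$, we have $\mathcal{G}_i^i(u)\ge 0$ and $\mathcal{G}_i^i(u)\ge -\mathcal{G}_i^{\neg i}(u)$.
   Context: There are two agents $1,2$ with additive valuations $v_1,v_2\ge 0$ over a set of $m$ goods, $m$ a power of $2$; for $i\in\{1,2\}$, $\neg i$ denotes the other agent. $T$ is a complete balanced binary tree whose leaves are the goods; each internal node $u$ has two children $L(u),R(u)$. For each node $u$ and agent $j$, define recursively the game at $u$ with $j$ moving first, which produces an allocation of the goods in the subtree of $u$: if $u$ is a leaf (good $g$), agent $j$ receives $g$ and $\neg j$ receives nothing; if $u$ is internal, agent $j$ chooses a child $C_j(u)\in\{L(u),R(u)\}$ maximizing $\mathcal{G}_j^j(\cdot)$ (ties broken deterministically), and with $D_j(u)$ the other child, the outcome is the union of the game at $C_j(u)$ with $j$ moving first and the game at $D_j(u)$ with $\neg j$ moving first. Let $\mathcal{A}_i(u,j)$ be the set of goods agent $i$ receives in the game at $u$ with $j$ moving first, and define the utility gap $\mathcal{G}_i^j(u):=v_i(\mathcal{A}_i(u,j))-v_i(\mathcal{A}_{\neg i}(u,j))$ (here $i$ and $j$ may coincide).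
   Formalization: The valuations $v_1,v_2$ take nonnegative rational values rather than nonnegative real ones. -}

module Defs where

open import Data.Nat using (ℕ; zero; suc)
open import Data.Bool using (Bool; true; false; if_then_else_)
open import Data.List using (List; []; _∷_; _++_; foldr; map)
open import Data.Product using (_×_; _,_; proj₁; proj₂)
open import Data.Rational using (ℚ; 0ℚ; _+_; _-_)
open import Data.Rational.Properties using (<-cmp)
open import Relation.Binary.Definitions using (tri<; tri≈; tri>)

data Agent : Set where
  a₁ a₂ : Agent

other : Agent → Agent
other a₁ = a₂
other a₂ = a₁

-- Complete balanced binary tree of depth d whose leaves are labelled by goods.
data BTree (G : Set) : ℕ → Set where
  leaf : G → BTree G zero
  node : ∀ {d} → BTree G d → BTree G d → BTree G (suc d)

leaves : {G : Set} {d : ℕ} → BTree G d → List G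
leaves (leaf g)   = g ∷ []
leaves (node l r) = leaves l ++ leaves r

-- u is a node of T (u is a subtree of T, possibly T itself).
data IsNode {G : Set} {k : ℕ} (u : BTree G k) : ∀ {d} → BTree G d → Set where
  here  : IsNode u u
  left  : ∀ {d} {l r : BTree G d} → IsNode u l → IsNode u (node l r)
  right : ∀ {d} {l r : BTree G d} → IsNode u r → IsNode u (node l r)

data Side : Set where
  L R : Side

val : {G : Set} → (G → ℚ) → List G → ℚ
val v = foldr (λ g s → v g + s) 0ℚ

-- An allocation of the goods in a subtree: (goods of agent a₁ , goods of agent a₂).
Alloc : Set → Set
Alloc G = List G × List G

bundle : {G : Set} → Agent → Alloc G → List G
bundle a₁ = proj₁
bundle a₂ = proj₂

give : {G : Set} → Agent → G → Alloc G
give a₁ g = (g ∷ [] , [])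
give a₂ g = ([] , g ∷ [])

_∪_ : {G : Set} → Alloc G → Alloc G → Alloc G
(x₁ , x₂) ∪ (y₁ , y₂) = (x₁ ++ y₁ , x₂ ++ y₂)

-- Valuations of the two agents and a deterministic tie-breaking rule:
-- when agent j at internal node u is indifferent between the children,
-- it picks tb j u.
module Game {G : Set} (v : Agent → G → ℚ)
            (tb : Agent → ∀ {d} → BTree G (suc d) → Side) where

  gapOf : Agent → Alloc G → ℚ
  gapOf i A = val (v i) (bundle i A) - val (v i) (bundle (other i) A)

  choose : ∀ {d} → Agent → BTree G (suc d) → ℚ → ℚ → Side
  choose j u gl gr with <-cmp gl gr
  ... | tri< _ _ _ = R
  ... | tri≈ _ _ _ = tb j u
  ... | tri> _ _ _ = L

  -- game at u with j moving first; returns the allocation of the goods of u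
  game : ∀ {d} → Agent → BTree G d → Alloc G
  game j (leaf g)   = give j g
  game j (node l r) with choose j (node l r) (gapOf j (game j l)) (gapOf j (game j r))
  ... | L = game j l ∪ game (other j) r
  ... | R = game j r ∪ game (other j) l

  𝒜 : ∀ {d} → Agent → BTree G d → Agent → List G
  𝒜 i u j = bundle i (game j u)

  𝒢 : ∀ {d} → Agent → Agent → BTree G d → ℚ
  𝒢 i j u = val (v i) (𝒜 i u j) - val (v i) (𝒜 (other i) u j)

{-# OPTIONS --safe #-}
module Submission where

-- Write a(u) = 𝒢ᵢⁱ(u) and b(u) = 𝒢ᵢ^¬ⁱ(u). Utility gaps add over the two halves of an
-- allocation, so if i, moving first at u, takes child C and leaves D, then
-- a(u) = a(C) + b(D) with a(D) ≤ a(C); and if ¬i, moving first, takes C′ and leaves D′,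
-- then b(u) = b(C′) + a(D′). By induction a + b ≥ 0 everywhere: when C′ = C the sum
-- regroups as (a + b)(C) + (a + b)(D), and when C′ = D it equals 2 a(u) ≥ 2 (a + b)(D).
-- Hence a(u) ≥ (a + b)(D) ≥ 0 at internal nodes, and a = vᵢ(g) ≥ 0 at a leaf g.

open import Defs
open import Data.Nat using (ℕ; suc; _^_)
open import Data.Fin using (Fin)
open import Data.List using (List; []; _∷_; _++_; allFin)
open import Data.List.Relation.Binary.Permutation.Propositional using (_↭_)
open import Data.Product using (_×_; _,_)
open import Data.Sum using (_⊎_; inj₁; inj₂)
open import Data.Rational using (ℚ; 0ℚ; _≤_; -_; _+_; _-_)
open import Data.Rational.Properties
open import Relation.Binary.Definitions using (tri<; tri≈; tri>)
open import Relation.Binary.PropositionalEquality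
open import Algebra.Bundles using (CommutativeMonoid)
open import Algebra.Properties.CommutativeSemigroup
  (CommutativeMonoid.commutativeSemigroup +-0-commutativeMonoid) using (interchange)

other-involutive : ∀ i → other (other i) ≡ i
other-involutive a₁ = refl
other-involutive a₂ = refl

bundle-∪ : {G : Set} (i : Agent) (X Y : Alloc G) → bundle i (X ∪ Y) ≡ bundle i X ++ bundle i Y
bundle-∪ a₁ X Y = refl
bundle-∪ a₂ X Y = refl

val-++ : {G : Set} (f : G → ℚ) (xs ys : List G) → val f (xs ++ ys) ≡ val f xs + val f ys
val-++ f []       ys = sym (+-identityˡ _)
val-++ f (x ∷ xs) ys = trans (cong (f x +_) (val-++ f xs ys)) (sym (+-assoc (f x) _ _))

+-‿-interchange : ∀ x y z w → (x + y) - (z + w) ≡ (x - z) + (y - w)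
+-‿-interchange x y z w = trans (cong ((x + y) +_) (neg-distrib-+ z w)) (interchange x y (- z) (- w))

nonneg-+-monoˡ : ∀ {a a′ b} → a′ ≤ a → 0ℚ ≤ a′ + b → 0ℚ ≤ a + b
nonneg-+-monoˡ {b = b} a′≤a 0≤a′+b = ≤-trans 0≤a′+b (+-monoˡ-≤ b a′≤a)

nonneg-crossed : ∀ a b a′ b′ → 0ℚ ≤ a + b → 0ℚ ≤ a′ + b′ → 0ℚ ≤ (a + b′) + (b + a′)
nonneg-crossed a b a′ b′ 0≤a+b 0≤a′+b′ =
  subst (0ℚ ≤_) (trans (cong ((a + b) +_) (+-comm a′ b′)) (interchange a b b′ a′))
        (+-mono-≤ 0≤a+b 0≤a′+b′)

nonneg-doubled : ∀ a b → 0ℚ ≤ a + b → 0ℚ ≤ (a + b) + (b + a)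
nonneg-doubled a b 0≤a+b = +-mono-≤ 0≤a+b (subst (0ℚ ≤_) (+-comm a b) 0≤a+b)

nonneg-+⇒-≤ : ∀ {a b} → 0ℚ ≤ a + b → - b ≤ a
nonneg-+⇒-≤ {a} {b} 0≤a+b = subst₂ _≤_ (+-identityˡ (- b)) a+b-b≡a (+-monoˡ-≤ (- b) 0≤a+b)
  where
  a+b-b≡a : (a + b) - b ≡ a
  a+b-b≡a = trans (+-assoc a b (- b)) (trans (cong (a +_) (+-inverseʳ b)) (+-identityʳ a))

first-mover-nonneg : ∀ {a aₗ bₗ aᵣ bᵣ} → 0ℚ ≤ aₗ + bₗ → 0ℚ ≤ aᵣ + bᵣ →
  (a ≡ aₗ + bᵣ × aᵣ ≤ aₗ) ⊎ (a ≡ aᵣ + bₗ × aₗ ≤ aᵣ) → 0ℚ ≤ a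
first-mover-nonneg {bᵣ = bᵣ} _ 0≤aᵣ+bᵣ (inj₁ (refl , aᵣ≤aₗ)) = nonneg-+-monoˡ {b = bᵣ} aᵣ≤aₗ 0≤aᵣ+bᵣ
first-mover-nonneg {bₗ = bₗ} 0≤aₗ+bₗ _ (inj₂ (refl , aₗ≤aᵣ)) = nonneg-+-monoˡ {b = bₗ} aₗ≤aᵣ 0≤aₗ+bₗ

node-sum-nonneg : ∀ {a b aₗ bₗ aᵣ bᵣ} → 0ℚ ≤ aₗ + bₗ → 0ℚ ≤ aᵣ + bᵣ →
  (a ≡ aₗ + bᵣ × aᵣ ≤ aₗ) ⊎ (a ≡ aᵣ + bₗ × aₗ ≤ aᵣ) →
  (b ≡ bₗ + aᵣ) ⊎ (b ≡ bᵣ + aₗ) → 0ℚ ≤ a + b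
node-sum-nonneg {aₗ = aₗ} {bₗ} {aᵣ} {bᵣ} hₗ hᵣ (inj₁ (refl , _)) (inj₁ refl) =
  nonneg-crossed aₗ bₗ aᵣ bᵣ hₗ hᵣ
node-sum-nonneg {aₗ = aₗ} {bₗ} {aᵣ} {bᵣ} hₗ hᵣ own@(inj₁ (refl , _)) (inj₂ refl) =
  nonneg-doubled aₗ bᵣ (first-mover-nonneg hₗ hᵣ own)
node-sum-nonneg {aₗ = aₗ} {bₗ} {aᵣ} {bᵣ} hₗ hᵣ own@(inj₂ (refl , _)) (inj₁ refl) =
  nonneg-doubled aᵣ bₗ (first-mover-nonneg hₗ hᵣ own)
node-sum-nonneg {aₗ = aₗ} {bₗ} {aᵣ} {bᵣ} hₗ hᵣ (inj₂ (refl , _)) (inj₂ refl) =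
  nonneg-crossed aᵣ bᵣ aₗ bₗ hᵣ hₗ

module _ {G : Set} (v : Agent → G → ℚ) (tb : Agent → ∀ {d} → BTree G (suc d) → Side) where
  open Game v tb

  gapOf-∪ : ∀ i (X Y : Alloc G) → gapOf i (X ∪ Y) ≡ gapOf i X + gapOf i Y
  gapOf-∪ i X Y = begin
    gapOf i (X ∪ Y)
      ≡⟨ cong₂ _-_ (val-bundle-∪ i) (val-bundle-∪ (other i)) ⟩
    (val (v i) (bundle i X) + val (v i) (bundle i Y))
      - (val (v i) (bundle (other i) X) + val (v i) (bundle (other i) Y))
      ≡⟨ +-‿-interchange (val (v i) (bundle i X)) (val (v i) (bundle i Y)) _ _ ⟩
    gapOf i X + gapOf i Y ∎
    where
    open ≡-Reasoning
    val-bundle-∪ : ∀ k → val (v i) (bundle k (X ∪ Y)) ≡ val (v i) (bundle k X) + val (v i) (bundle k Y)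
    val-bundle-∪ k = trans (cong (val (v i)) (bundle-∪ k X Y)) (val-++ (v i) (bundle k X) (bundle k Y))

  choose-L : ∀ {d} j (u : BTree G (suc d)) x y → choose j u x y ≡ L → y ≤ x
  choose-L j u x y chose with <-cmp x y
  ... | tri≈ _ x≡y _ = ≤-reflexive (sym x≡y)
  ... | tri> _ _ x>y = <⇒≤ x>y

  choose-R : ∀ {d} j (u : BTree G (suc d)) x y → choose j u x y ≡ R → x ≤ y
  choose-R j u x y chose with <-cmp x y
  ... | tri< x<y _ _ = <⇒≤ x<y
  ... | tri≈ _ x≡y _ = ≤-reflexive x≡y

  data Split (j : Agent) {d} (l r : BTree G d) : Alloc G → Set where
    takes-left  : gapOf j (game j r) ≤ gapOf j (game j l) → Split j l r (game j l ∪ game (other j) r)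
    takes-right : gapOf j (game j l) ≤ gapOf j (game j r) → Split j l r (game j r ∪ game (other j) l)

  split : ∀ j {d} (l r : BTree G d) → Split j l r (game j (node l r))
  split j l r with choose j (node l r) (gapOf j (game j l)) (gapOf j (game j r)) in chose
  ... | L = takes-left  (choose-L j (node l r) _ _ chose)
  ... | R = takes-right (choose-R j (node l r) _ _ chose)

  𝒢-node : ∀ i j {d} (l r : BTree G d) →
    (𝒢 i j (node l r) ≡ 𝒢 i j l + 𝒢 i (other j) r × 𝒢 j j r ≤ 𝒢 j j l)
    ⊎ (𝒢 i j (node l r) ≡ 𝒢 i j r + 𝒢 i (other j) l × 𝒢 j j l ≤ 𝒢 j j r)
  𝒢-node i j l r with game j (node l r) | split j l r
  ... | _ | takes-left  r≤l = inj₁ (gapOf-∪ i (game j l) (game (other j) r) , r≤l)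
  ... | _ | takes-right l≤r = inj₂ (gapOf-∪ i (game j r) (game (other j) l) , l≤r)

  𝒢-own-node : ∀ i {d} (l r : BTree G d) →
    (𝒢 i i (node l r) ≡ 𝒢 i i l + 𝒢 i (other i) r × 𝒢 i i r ≤ 𝒢 i i l)
    ⊎ (𝒢 i i (node l r) ≡ 𝒢 i i r + 𝒢 i (other i) l × 𝒢 i i l ≤ 𝒢 i i r)
  𝒢-own-node i = 𝒢-node i i

  𝒢-opp-node : ∀ i {d} (l r : BTree G d) →
    (𝒢 i (other i) (node l r) ≡ 𝒢 i (other i) l + 𝒢 i i r)
    ⊎ (𝒢 i (other i) (node l r) ≡ 𝒢 i (other i) r + 𝒢 i i l)
  𝒢-opp-node i l r with 𝒢-node i (other i) l r
  ... | inj₁ (eq , _) = inj₁ (trans eq (cong (λ k → 𝒢 i (other i) l + 𝒢 i k r) (other-involutive i)))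
  ... | inj₂ (eq , _) = inj₂ (trans eq (cong (λ k → 𝒢 i (other i) r + 𝒢 i k l) (other-involutive i)))

  𝒢-own-leaf : ∀ i g → 𝒢 i i (leaf g) ≡ v i g
  𝒢-own-leaf a₁ g = trans (+-identityʳ _) (+-identityʳ _)
  𝒢-own-leaf a₂ g = trans (+-identityʳ _) (+-identityʳ _)

  𝒢-opp-leaf : ∀ i g → 𝒢 i (other i) (leaf g) ≡ - v i g
  𝒢-opp-leaf a₁ g = trans (+-identityˡ _) (cong -_ (+-identityʳ _))
  𝒢-opp-leaf a₂ g = trans (+-identityˡ _) (cong -_ (+-identityʳ _))

  𝒢-own+opp-nonneg : ∀ i {d} (u : BTree G d) → 0ℚ ≤ 𝒢 i i u + 𝒢 i (other i) u
  𝒢-own+opp-nonneg i (leaf g) = ≤-reflexive (sym (begin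
    𝒢 i i (leaf g) + 𝒢 i (other i) (leaf g) ≡⟨ cong₂ _+_ (𝒢-own-leaf i g) (𝒢-opp-leaf i g) ⟩
    v i g - v i g                           ≡⟨ +-inverseʳ (v i g) ⟩
    0ℚ                                      ∎))
    where open ≡-Reasoning
  𝒢-own+opp-nonneg i (node l r) =
    node-sum-nonneg (𝒢-own+opp-nonneg i l) (𝒢-own+opp-nonneg i r) (𝒢-own-node i l r) (𝒢-opp-node i l r)

  𝒢-own-nonneg : ∀ i → (∀ g → 0ℚ ≤ v i g) → ∀ {d} (u : BTree G d) → 0ℚ ≤ 𝒢 i i u
  𝒢-own-nonneg i vᵢ≥0 (leaf g)   = subst (0ℚ ≤_) (sym (𝒢-own-leaf i g)) (vᵢ≥0 g)
  𝒢-own-nonneg i _    (node l r) =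
    first-mover-nonneg (𝒢-own+opp-nonneg i l) (𝒢-own+opp-nonneg i r) (𝒢-own-node i l r)

-- T, its leaf labelling and u ∈ T are unused: the bounds hold at every tree u.
lemma27 : (d : ℕ) (v : Agent → Fin (2 ^ d) → ℚ)
    → (∀ i g → 0ℚ ≤ v i g)
    → (tb : Agent → ∀ {k} → BTree (Fin (2 ^ d)) (suc k) → Side)
    → (T : BTree (Fin (2 ^ d)) d)
    → leaves T ↭ allFin (2 ^ d)
    → ∀ {k} (u : BTree (Fin (2 ^ d)) k) → IsNode u T
    → (i : Agent)
    → (0ℚ ≤ Game.𝒢 v tb i i u)
    × (- Game.𝒢 v tb i (other i) u ≤ Game.𝒢 v tb i i u)
lemma27 d v v≥0 tb T _ u _ i =
  𝒢-own-nonneg v tb i (v≥0 i) u , nonneg-+⇒-≤ (𝒢-own+opp-nonneg v tb i u)
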